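{- Suppose the following statement (*) holds: for all integers $A,a,B,b$ with $A\ge B\ge 0$ and $a\ge b\ge 0$ there is an injection $\gamma:\mathcal{U}^A_b\times\mathcal{U}^B_a\hookrightarrow\mathcal{U}^A_a\times\mathcal{U}^B_b$ such that for all $(\lambda_1,\mu_1)\in\mathcal{U}^A_b\times\mathcal{U}^B_a$, the pair $(\lambda_2,\mu_2)=\gamma((\lambda_1,\mu_1))$ satisfies $\lambda_1\mu_1\trianglerighteq\lambda_2\mu_2$. Then for every sequence of real numbers $p=\{p_n\}_{n\ge0}$, $\mathcal{T}_p\in TN_2$ implies $\mathcal{S}_p\in TN_2$.
   Context: $\mathbb{N}$ is the set of non-negative integers; $[m]=\{1,\ldots,m\}$, $[0]=\emptyset$. A composition with $m$ non-negative parts is a function $\lambda:[m]\to\mathbb{N}$; its weight is $|\lambda|=\sum_{i\in[m]}\lambda(i)$; $\mathcal{U}^m_n$ is the set of such compositions of weight $n$. For $\lambda\in\mathcal{U}^A_a$, $\mu\in\mathcal{U}^B_b$, the concatenation $\lambda\mu\in\mathcal{U}^{A+B}_{a+b}$ is given by $(\lambda\mu)(i)=\lambda(i)$ for $i\in[A]$ and $(\lambda\mu)(i)=\mu(i-A)$ for $i\in[A+B]\setminus[A]$. For $\lambda,\mu\in\mathcal{U}^m$, $\lambda\trianglerighteq\mu$ means that, letting $\lambda_p,\mu_p$ be the non-increasing rearrangements, $|\lambda|=|\mu|$ and $\sum_{i=1}^j\lambda_p(i)\ge\sum_{i=1}^j\mu_p(i)$ for all $1\le j\le m$. $\mathcal{T}_p$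 is the $\mathbb{N}\times\mathbb{N}$ matrix with $(\mathcal{T}_p)_{i,j}=p_{j-i}$ (with $p_n=0$ for $n<0$). With $p(x)=\sum_n p_nx^n$ and $(p^i)_j$ the coefficient of $x^j$ in $(p(x))^i$ (with $(p(x))^0=1$), $\mathcal{S}_p$ is the $\mathbb{N}\times\mathbb{N}$ matrix with $(\mathcal{S}_p)_{i,j}=(p^i)_j$. A matrix is $TN_2$ if all its minors of order at most $2$ are non-negative. -}

module Defs where

open import Level using (Level; _⊔_) renaming (suc to lsuc)
open import Data.Nat using (ℕ; zero; suc; _∸_) renaming (_≤_ to _≤ℕ_; _<_ to _<ℕ_; _+_ to _+ℕ_)
import Data.Nat.Properties as ℕP
open import Data.List using (List; take)
open import Data.Nat.ListAction using () renaming (sum to sumL)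
open import Data.Vec using (Vec; toList; _++_) renaming (sum to sumV)
open import Data.Product using (Σ; ∃; _×_; _,_; proj₁)
open import Relation.Nullary using (¬_)
open import Relation.Binary using (Rel; IsTotalOrder)
open import Relation.Binary.PropositionalEquality using (_≡_)
open import Algebra.Bundles using (CommutativeRing)
open import Function.Definitions using (Injective)
import Relation.Binary.Construct.Flip.EqAndOrd as Flip
import Data.List.Sort.InsertionSort as IS

-- Compositions with m non-negative parts and weight n:  𝒰^m_n
-- (a composition λ : [m] → ℕ is represented as the vector (λ(1),…,λ(m)))

Comp : ℕ → ℕ → Set
Comp m n = Σ (Vec ℕ m) (λ v → sumV v ≡ n)

concat : ∀ {A a B b} → Comp A a × Comp B b → Vec ℕ (A +ℕ B)
concat ((l , _) , (m , _)) = l ++ m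

module Desc = IS (Flip.decTotalOrder ℕP.≤-decTotalOrder)

decreasing : ∀ {m} → Vec ℕ m → List ℕ
decreasing v = Desc.sort (toList v)

_⊵_ : ∀ {m} → Vec ℕ m → Vec ℕ m → Set
_⊵_ {m} l u = (sumV l ≡ sumV u) ×
  (∀ j → 1 ≤ℕ j → j ≤ℕ m → sumL (take j (decreasing u)) ≤ℕ sumL (take j (decreasing l)))

Star : Set
Star = ∀ (A a B b : ℕ) → B ≤ℕ A → b ≤ℕ a →
  Σ (Comp A b × Comp B a → Comp A a × Comp B b) (λ γ →
    Injective _≡_ _≡_ γ × (∀ x → concat x ⊵ concat (γ x)))

-- The real numbers, axiomatised as a (Dedekind-)complete ordered field.
-- Quantifying over every such structure is exactly quantifying over ℝ
-- (all complete ordered fields are isomorphic).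

record CompleteOrderedField c ℓ₁ ℓ₂ : Set (lsuc (c ⊔ ℓ₁ ⊔ ℓ₂)) where
  field
    commRing : CommutativeRing c ℓ₁
  open CommutativeRing commRing public
  field
    _≤_          : Rel Carrier ℓ₂
    isTotalOrder : IsTotalOrder _≈_ _≤_
    +-mono-≤     : ∀ {x y} z → x ≤ y → (x + z) ≤ (y + z)
    *-nonneg     : ∀ {x y} → 0# ≤ x → 0# ≤ y → 0# ≤ (x * y)
    0≉1          : ¬ (0# ≈ 1#)
    inverse      : ∀ x → ¬ (x ≈ 0#) → ∃ λ y → (x * y) ≈ 1#
    complete     : (P : Carrier → Set c) → ∃ P →
                   (∃ λ u → ∀ x → P x → x ≤ u) →
                   ∃ λ s → (∀ x → P x → x ≤ s) ×
                           (∀ u → (∀ x → P x → x ≤ u) → s ≤ u)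

module _ {c ℓ₁ ℓ₂} (R : CompleteOrderedField c ℓ₁ ℓ₂) where
  open CompleteOrderedField R

  Matrix : Set c
  Matrix = ℕ → ℕ → Carrier

  sumRange : ℕ → (ℕ → Carrier) → Carrier
  sumRange zero    f = 0#
  sumRange (suc n) f = sumRange n f + f n

  conv : (ℕ → Carrier) → (ℕ → Carrier) → ℕ → Carrier
  conv f g n = sumRange (suc n) (λ k → f k * g (n ∸ k))

  powCoeff : (ℕ → Carrier) → ℕ → ℕ → Carrier
  powCoeff p zero    zero    = 1#
  powCoeff p zero    (suc j) = 0#
  powCoeff p (suc i) j       = conv p (powCoeff p i) j

  𝒯 : (ℕ → Carrier) → Matrix
  𝒯 p i j with j ℕP.<? i
  ... | Relation.Nullary.yes _ = 0#
  ... | Relation.Nullary.no  _ = p (j ∸ i)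

  𝒮 : (ℕ → Carrier) → Matrix
  𝒮 p i j = powCoeff p i j

  TN₂ : Matrix → Set (ℓ₂)
  TN₂ M = (∀ i j → 0# ≤ M i j) ×
          (∀ i i' j j' → i <ℕ i' → j <ℕ j' →
             0# ≤ ((M i j * M i' j') - (M i j' * M i' j)))

module Submission where

-- Write p^(λ) = ∏ᵢ p_{λ(i)} for the weight of a composition λ.  The proof has
-- three ingredients.
--   1. Expansion: (p^i)_j = Σ_{λ ∈ 𝒰^i_j} p^(λ), by induction on i.  Hence
--      every entry of 𝒮_p is non-negative and each product of two entries of
--      𝒮_p is a sum of p^(λμ) over pairs (λ , μ).
--   2. Exchange: 𝒯_p ∈ TN₂ gives p_n ≥ 0 and, from the minor on rows 0, k and
--      columns a + k, M + k, the inequality p_{M+k} p_a ≤ p_M p_{a+k} (a ≤ M).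
--   3. Dominance: for such p, λ ⊵ μ implies p^(λ) ≤ p^(μ).  Sorting both
--      decreasingly, the first part a of λ exceeds the first part b of μ by
--      some d; moving d onto the first later part of λ that is ≤ b does not
--      decrease the weight (by 2) and keeps dominance, so we may recurse.
-- For a minor with rows i < i', columns j < j', (*) gives an injection γ of
-- 𝒰^{i'}_j × 𝒰^i_{j'} into 𝒰^{i'}_{j'} × 𝒰^i_j decreasing in dominance, so
-- by 3 the negative term of the minor is termwise at most a sub-sum of the
-- positive one.

open import Defs
open import Data.Nat using (ℕ; zero; suc; _∸_; z≤n; s≤s)
  renaming (_≤_ to _≤ℕ_; _<_ to _<ℕ_; _+_ to _+ℕ_)
import Data.Nat.Properties as ℕP
open import Data.Nat.ListAction using () renaming (sum to sumL)
import Data.Nat.ListAction.Properties as SumL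
open import Data.List using (List; []; _∷_; [_]; _++_; map; foldr; take; length; cartesianProduct)
import Data.List.Properties as LP
open import Data.List.Membership.Propositional using (_∈_)
open import Data.List.Membership.Propositional.Properties
  using (∈-map⁺; ∈-map⁻; ∈-++⁺ˡ; ∈-++⁺ʳ; ∈-∃++; ∈-cartesianProduct⁺)
open import Data.List.Relation.Unary.Any using (here; there)
open import Data.List.Relation.Unary.All using (All; []; _∷_)
import Data.List.Relation.Unary.All as All
open import Data.List.Relation.Unary.AllPairs using (AllPairs; []; _∷_)
open import Data.List.Relation.Unary.Linked.Properties using (Linked⇒AllPairs)
open import Data.List.Relation.Unary.Unique.Propositional using (Unique)
import Data.List.Relation.Unary.Unique.Propositional.Properties as Unique
open import Data.List.Relation.Binary.Permutation.Propositional using (_↭_; ↭⇒↭ₛ′)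
import Data.List.Relation.Binary.Permutation.Propositional.Properties as Perm
import Data.List.Relation.Binary.Permutation.Setoid.Properties as SetoidPerm
import Data.List.Sort.InsertionSort.Properties as SortProperties
open import Data.Vec using (Vec; []; _∷_; toList; head) renaming (sum to sumV)
import Data.Vec.Properties as VP
open import Data.Product using (∃; _,_; proj₁; proj₂; _×_)
open import Data.Sum using (inj₁; inj₂)
open import Data.Empty using (⊥; ⊥-elim)
open import Function.Definitions using (Injective)
open import Relation.Nullary using (yes; no)
open import Relation.Binary.Bundles using (Poset)
open import Relation.Binary.Structures using (IsTotalOrder)
open import Relation.Binary.PropositionalEquality
  using (_≡_; _≢_; refl; cong; cong₂; subst; subst₂; module ≡-Reasoning)
  renaming (sym to ≡-sym; trans to ≡-trans)
import Relation.Binary.Construct.Flip.EqAndOrd as Flip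
import Relation.Binary.Reasoning.Setoid as SetoidReasoning
import Relation.Binary.Reasoning.PartialOrder as PosetReasoning
import Algebra.Properties.Ring as RingProperties

module OrderedField {c ℓ₁ ℓ₂} (R : CompleteOrderedField c ℓ₁ ℓ₂) where
  open CompleteOrderedField R
    renaming (refl to ≈-refl; sym to ≈-sym; trans to ≈-trans; reflexive to ≈-reflexive)
  open RingProperties ring using (-‿distribˡ-*; -‿distribʳ-*; -‿involutive)
  import Algebra.Properties.CommutativeSemigroup +-commutativeSemigroup as +-CS
  open IsTotalOrder isTotalOrder public
    using (total; isPartialOrder)
    renaming (refl to ≤-refl; trans to ≤-trans; reflexive to ≤-reflexive;
              ≲-respˡ-≈ to ≤-respˡ; ≲-respʳ-≈ to ≤-respʳ)

  poset : Poset c ℓ₁ ℓ₂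
  poset = record { Carrier = Carrier ; _≈_ = _≈_ ; _≤_ = _≤_ ; isPartialOrder = isPartialOrder }

  module ≈-Reasoning = SetoidReasoning setoid
  module ≤-Reasoning = PosetReasoning poset

  +-monoʳ-≤ : ∀ z {x y} → x ≤ y → (z + x) ≤ (z + y)
  +-monoʳ-≤ z {x} {y} x≤y = ≤-respˡ (+-comm x z) (≤-respʳ (+-comm y z) (+-mono-≤ z x≤y))

  +-mono : ∀ {a b x y} → a ≤ b → x ≤ y → (a + x) ≤ (b + y)
  +-mono {b = b} {x = x} a≤b x≤y = ≤-trans (+-mono-≤ x a≤b) (+-monoʳ-≤ b x≤y)

  +-nonneg : ∀ {a b} → 0# ≤ a → 0# ≤ b → 0# ≤ (a + b)
  +-nonneg 0≤a 0≤b = ≤-respˡ (+-identityˡ 0#) (+-mono 0≤a 0≤b)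

  0≤y-x⇒x≤y : ∀ {x y} → 0# ≤ (y - x) → x ≤ y
  0≤y-x⇒x≤y {x} {y} 0≤y-x = ≤-respˡ (+-identityˡ x) (≤-respʳ y-x+x≈y (+-mono-≤ x 0≤y-x))
    where
    open ≈-Reasoning
    y-x+x≈y : ((y - x) + x) ≈ y
    y-x+x≈y = begin
      (y - x) + x    ≈⟨ +-assoc y (- x) x ⟩
      y + (- x + x)  ≈⟨ +-cong ≈-refl (-‿inverseˡ x) ⟩
      y + 0#         ≈⟨ +-identityʳ y ⟩
      y              ∎

  x≤y⇒0≤y-x : ∀ {x y} → x ≤ y → 0# ≤ (y - x)
  x≤y⇒0≤y-x {x} x≤y = ≤-respˡ (-‿inverseʳ x) (+-mono-≤ (- x) x≤y)

  *-monoˡ-≤ : ∀ z {x y} → 0# ≤ z → x ≤ y → (z * x) ≤ (z * y)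
  *-monoˡ-≤ z {x} {y} 0≤z x≤y =
    0≤y-x⇒x≤y (≤-respʳ z[y-x]≈zy-zx (*-nonneg 0≤z (x≤y⇒0≤y-x x≤y)))
    where
    open ≈-Reasoning
    z[y-x]≈zy-zx : (z * (y - x)) ≈ ((z * y) - (z * x))
    z[y-x]≈zy-zx = begin
      z * (y - x)          ≈⟨ distribˡ z y (- x) ⟩
      z * y + z * - x      ≈⟨ +-cong ≈-refl (≈-sym (-‿distribʳ-* z x)) ⟩
      z * y + - (z * x)    ∎

  *-monoʳ-≤ : ∀ z {x y} → 0# ≤ z → x ≤ y → (x * z) ≤ (y * z)
  *-monoʳ-≤ z {x} {y} 0≤z x≤y = ≤-respˡ (*-comm z x) (≤-respʳ (*-comm z y) (*-monoˡ-≤ z 0≤z x≤y))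

  -- if 1 ≤ 0 then 0 ≤ -1, hence 0 ≤ (-1)(-1) = 1 anyway
  0≤1 : 0# ≤ 1#
  0≤1 with total 0# 1#
  ... | inj₁ 0≤1 = 0≤1
  ... | inj₂ 1≤0 = ≤-respʳ -1*-1≈1 (*-nonneg 0≤-1 0≤-1)
    where
    open ≈-Reasoning
    0≤-1 : 0# ≤ (- 1#)
    0≤-1 = ≤-respˡ (-‿inverseʳ 1#) (≤-respʳ (+-identityˡ (- 1#)) (+-mono-≤ (- 1#) 1≤0))
    -1*-1≈1 : (- 1# * - 1#) ≈ 1#
    -1*-1≈1 = begin
      - 1# * - 1#      ≈⟨ ≈-sym (-‿distribˡ-* 1# (- 1#)) ⟩
      - (1# * - 1#)    ≈⟨ -‿cong (*-identityˡ (- 1#)) ⟩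
      - (- 1#)         ≈⟨ -‿involutive 1# ⟩
      1#               ∎

  ∑ : {A : Set} → (A → Carrier) → List A → Carrier
  ∑ f []       = 0#
  ∑ f (x ∷ xs) = f x + ∑ f xs

  ∑-++ : {A : Set} (f : A → Carrier) (xs ys : List A) → ∑ f (xs ++ ys) ≈ (∑ f xs + ∑ f ys)
  ∑-++ f []       ys = ≈-sym (+-identityˡ _)
  ∑-++ f (x ∷ xs) ys = ≈-trans (+-cong ≈-refl (∑-++ f xs ys)) (≈-sym (+-assoc _ _ _))

  ∑-map : {A B : Set} (f : B → Carrier) (g : A → B) (xs : List A) → ∑ f (map g xs) ≡ ∑ (λ x → f (g x)) xs
  ∑-map f g []       = refl
  ∑-map f g (x ∷ xs) = cong (f (g x) +_) (∑-map f g xs)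

  ∑-cong : {A : Set} {f g : A → Carrier} → (∀ x → f x ≈ g x) → ∀ xs → ∑ f xs ≈ ∑ g xs
  ∑-cong f≈g []       = ≈-refl
  ∑-cong f≈g (x ∷ xs) = +-cong (f≈g x) (∑-cong f≈g xs)

  ∑-scale : {A : Set} (k : Carrier) (f : A → Carrier) (xs : List A) → ∑ (λ x → k * f x) xs ≈ (k * ∑ f xs)
  ∑-scale k f []       = ≈-sym (zeroʳ k)
  ∑-scale k f (x ∷ xs) = ≈-trans (+-cong ≈-refl (∑-scale k f xs)) (≈-sym (distribˡ k _ _))

  ∑-nonneg : {A : Set} (f : A → Carrier) → (∀ x → 0# ≤ f x) → ∀ xs → 0# ≤ ∑ f xs
  ∑-nonneg f f≥0 []       = ≤-refl
  ∑-nonneg f f≥0 (x ∷ xs) = +-nonneg (f≥0 x) (∑-nonneg f f≥0 xs)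

  ∑-mono : {A : Set} {f g : A → Carrier} → (∀ x → f x ≤ g x) → ∀ xs → ∑ f xs ≤ ∑ g xs
  ∑-mono f≤g []       = ≤-refl
  ∑-mono f≤g (x ∷ xs) = +-mono (f≤g x) (∑-mono f≤g xs)

  ∑-cartesian : {A B : Set} (f : A → Carrier) (g : B → Carrier) (xs : List A) (ys : List B) →
    ∑ (λ q → f (proj₁ q) * g (proj₂ q)) (cartesianProduct xs ys) ≈ (∑ f xs * ∑ g ys)
  ∑-cartesian f g []       ys = ≈-sym (zeroˡ _)
  ∑-cartesian {A} {B} f g (x ∷ xs) ys = begin
    ∑ fg (map (x ,_) ys ++ cartesianProduct xs ys)
      ≈⟨ ∑-++ fg (map (x ,_) ys) (cartesianProduct xs ys) ⟩
    ∑ fg (map (x ,_) ys) + ∑ fg (cartesianProduct xs ys)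
      ≈⟨ +-cong (≈-trans (≈-reflexive (∑-map fg (x ,_) ys)) (∑-scale (f x) g ys)) (∑-cartesian f g xs ys) ⟩
    f x * ∑ g ys + ∑ f xs * ∑ g ys
      ≈⟨ ≈-sym (distribʳ _ _ _) ⟩
    (f x + ∑ f xs) * ∑ g ys ∎
    where
    open ≈-Reasoning
    fg : A × B → Carrier
    fg q = f (proj₁ q) * g (proj₂ q)

  ∑-extract : {A : Set} (g : A → Carrier) {x : A} (as bs : List A) → ∑ g (as ++ x ∷ bs) ≈ (g x + ∑ g (as ++ bs))
  ∑-extract g []       bs = ≈-refl
  ∑-extract g (a ∷ as) bs = ≈-trans (+-cong ≈-refl (∑-extract g as bs)) (+-CS.x∙yz≈y∙xz _ _ _)

  ∈-delete : {A : Set} {x y : A} (as : List A) {bs : List A} → y ∈ as ++ x ∷ bs → x ≢ y → y ∈ as ++ bs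
  ∈-delete []       (here refl) x≢y = ⊥-elim (x≢y refl)
  ∈-delete []       (there y∈)  x≢y = y∈
  ∈-delete (a ∷ as) (here y≡a)  x≢y = here y≡a
  ∈-delete (a ∷ as) (there y∈)  x≢y = there (∈-delete as y∈ x≢y)

  ∑-sublist : {A : Set} (g : A → Carrier) → (∀ x → 0# ≤ g x) → ∀ xs ys → Unique xs →
    (∀ {x} → x ∈ xs → x ∈ ys) → ∑ g xs ≤ ∑ g ys
  ∑-sublist g g≥0 []       ys _              _     = ∑-nonneg g g≥0 ys
  ∑-sublist g g≥0 (x ∷ xs) ys (x∉xs ∷ uxs) xs⊆ys with ∈-∃++ (xs⊆ys (here refl))
  ... | as , bs , refl =
    ≤-respʳ (≈-sym (∑-extract g as bs))
      (+-monoʳ-≤ (g x) (∑-sublist g g≥0 xs (as ++ bs) uxs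
        (λ y∈xs → ∈-delete as (xs⊆ys (there y∈xs)) (All.lookup x∉xs y∈xs))))

  ∑-injection : {A B : Set} (f : A → Carrier) (g : B → Carrier) (γ : A → B) →
    (∀ y → 0# ≤ g y) → Injective _≡_ _≡_ γ → (∀ x → f x ≤ g (γ x)) →
    ∀ xs ys → Unique xs → (∀ y → y ∈ ys) → ∑ f xs ≤ ∑ g ys
  ∑-injection f g γ g≥0 γ-inj f≤gγ xs ys uxs ys-all = begin
    ∑ f xs                ≤⟨ ∑-mono f≤gγ xs ⟩
    ∑ (λ x → g (γ x)) xs  ≡⟨ ≡-sym (∑-map g γ xs) ⟩
    ∑ g (map γ xs)        ≤⟨ ∑-sublist g g≥0 (map γ xs) ys (Unique.map⁺ γ-inj uxs) (λ {y} _ → ys-all y) ⟩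
    ∑ g ys                ∎
    where open ≤-Reasoning

  sumRange-cong : ∀ n {f g : ℕ → Carrier} → (∀ k → f k ≈ g k) → sumRange R n f ≈ sumRange R n g
  sumRange-cong zero    f≈g = ≈-refl
  sumRange-cong (suc n) f≈g = +-cong (sumRange-cong n f≈g) (f≈g n)

  sumRange-head : ∀ n (f : ℕ → Carrier) → sumRange R (suc n) f ≈ (f 0 + sumRange R n (λ k → f (suc k)))
  sumRange-head zero    f = ≈-trans (+-identityˡ _) (≈-sym (+-identityʳ _))
  sumRange-head (suc n) f = ≈-trans (+-cong (sumRange-head n f) ≈-refl) (+-assoc _ _ _)

-- A duplicate-free list of all compositions in 𝒰^m_n.  A composition with a
-- first part either starts with 0, or arises from one of weight n - 1 by
-- increasing its first part.
module Compositions where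

  prepend0 : ∀ {m n} → Comp m n → Comp (suc m) n
  prepend0 (v , Σv≡n) = 0 ∷ v , Σv≡n

  bumpHead : ∀ {m n} → Comp (suc m) n → Comp (suc m) (suc n)
  bumpHead (k ∷ v , Σv≡n) = suc k ∷ v , cong suc Σv≡n

  mutual
    compositions : ∀ m n → List (Comp m n)
    compositions zero    zero    = [ [] , refl ]
    compositions zero    (suc n) = []
    compositions (suc m) n       = compositionsSuc m n

    compositionsSuc : ∀ m n → List (Comp (suc m) n)
    compositionsSuc m zero    = map prepend0 (compositions m zero)
    compositionsSuc m (suc n) = map prepend0 (compositions m (suc n)) ++ map bumpHead (compositionsSuc m n)

  mutual
    compositions-complete : ∀ m n (λ′ : Comp m n) → λ′ ∈ compositions m n
    compositions-complete zero    .0 ([] , refl) = here refl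
    compositions-complete (suc m) n λ′          = compositionsSuc-complete m n λ′

    compositionsSuc-complete : ∀ m n (λ′ : Comp (suc m) n) → λ′ ∈ compositionsSuc m n
    compositionsSuc-complete m zero    (zero ∷ v , Σv≡0) = ∈-map⁺ prepend0 (compositions-complete m zero (v , Σv≡0))
    compositionsSuc-complete m (suc n) (zero ∷ v , Σv≡n) =
      ∈-++⁺ˡ (∈-map⁺ prepend0 (compositions-complete m (suc n) (v , Σv≡n)))
    compositionsSuc-complete m .(suc (k +ℕ sumV v)) (suc k ∷ v , refl) =
      ∈-++⁺ʳ (map prepend0 (compositions m _))
        (∈-map⁺ bumpHead (compositionsSuc-complete m (k +ℕ sumV v) (k ∷ v , refl)))

  Comp-≡ : ∀ {m n} {λ₁ λ₂ : Comp m n} → proj₁ λ₁ ≡ proj₁ λ₂ → λ₁ ≡ λ₂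
  Comp-≡ {λ₁ = v , p} {λ₂ = .v , q} refl = cong (v ,_) (ℕP.≡-irrelevant p q)

  prepend0-injective : ∀ {m n} → Injective _≡_ _≡_ (prepend0 {m} {n})
  prepend0-injective {x = v , _} {y = w , _} eq = Comp-≡ (VP.∷-injectiveʳ (cong proj₁ eq))

  bumpHead-injective : ∀ {m n} → Injective _≡_ _≡_ (bumpHead {m} {n})
  bumpHead-injective {x = k ∷ v , _} {y = l ∷ w , _} eq with VP.∷-injective (cong proj₁ eq)
  ... | refl , refl = Comp-≡ refl

  prepend0≢bumpHead : ∀ {m n} (λ₁ : Comp m (suc n)) (λ₂ : Comp (suc m) n) → prepend0 λ₁ ≢ bumpHead λ₂
  prepend0≢bumpHead (v , _) (k ∷ w , _) eq = ℕP.0≢1+n (cong (λ λ′ → head (proj₁ λ′)) eq)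

  mutual
    compositions-unique : ∀ m n → Unique (compositions m n)
    compositions-unique zero    zero    = [] ∷ []
    compositions-unique zero    (suc n) = []
    compositions-unique (suc m) n       = compositionsSuc-unique m n

    compositionsSuc-unique : ∀ m n → Unique (compositionsSuc m n)
    compositionsSuc-unique m zero    = Unique.map⁺ prepend0-injective (compositions-unique m zero)
    compositionsSuc-unique m (suc n) =
      Unique.++⁺ (Unique.map⁺ prepend0-injective (compositions-unique m (suc n)))
                 (Unique.map⁺ bumpHead-injective (compositionsSuc-unique m n))
                 disjoint
      where
      disjoint : ∀ {λ′} → λ′ ∈ map prepend0 (compositions m (suc n)) × λ′ ∈ map bumpHead (compositionsSuc m n) → ⊥
      disjoint (∈₁ , ∈₂) with ∈-map⁻ prepend0 ∈₁ | ∈-map⁻ bumpHead ∈₂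
      ... | λ₁ , _ , refl | λ₂ , _ , eq = prepend0≢bumpHead λ₁ λ₂ eq

-- Carry e xs ys says that xs,
-- with a surplus e added to its first entry, dominates ys prefix by prefix with
-- the same total; the surplus left after each position is made explicit.
module Carrying where
  open import Data.Nat using (_+_; _≤_)
  import Algebra.Properties.CommutativeSemigroup ℕP.+-commutativeSemigroup as ℕ+

  Carry : ℕ → List ℕ → List ℕ → Set
  Carry e []       []       = e ≡ 0
  Carry e []       (_ ∷ _)  = ⊥
  Carry e (_ ∷ _)  []       = ⊥
  Carry e (a ∷ xs) (b ∷ ys) = ∃ λ d → e + a ≡ b + d × Carry d xs ys

  addAt : ℕ → ℕ → List ℕ → List ℕ
  addAt k M []       = []
  addAt k M (a ∷ xs) with a ℕP.≤? M
  ... | yes _ = a + k ∷ xs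
  ... | no  _ = a ∷ addAt k M xs

  surplus-split : ∀ {e k a b d} → b ≤ a → e + k + a ≡ b + d →
    ∃ λ d′ → e + a ≡ b + d′ × d ≡ d′ + k
  surplus-split {e} {k} {a} {b} {d} b≤a eq = d′ , e+a≡b+d′ , ℕP.+-cancelˡ-≡ b d (d′ + k) b+d≡b+[d′+k]
    where
    open ≡-Reasoning
    d′ : ℕ
    d′ = e + (a ∸ b)
    e+a≡b+d′ : e + a ≡ b + d′
    e+a≡b+d′ = begin
      e + a               ≡⟨ cong (e +_) (≡-sym (ℕP.m+[n∸m]≡n b≤a)) ⟩
      e + (b + (a ∸ b))   ≡⟨ ℕ+.x∙yz≈y∙xz e b (a ∸ b) ⟩
      b + d′              ∎
    b+d≡b+[d′+k] : b + d ≡ b + (d′ + k)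
    b+d≡b+[d′+k] = begin
      b + d         ≡⟨ ≡-sym eq ⟩
      e + k + a     ≡⟨ ℕ+.xy∙z≈xz∙y e k a ⟩
      e + a + k     ≡⟨ cong (_+ k) e+a≡b+d′ ⟩
      b + d′ + k    ≡⟨ ℕP.+-assoc b d′ k ⟩
      b + (d′ + k)  ∎

  addAt-carry : ∀ e k M xs ys → All (_≤ M) ys → Carry (e + k) xs ys → Carry e (addAt k M xs) ys
  addAt-carry e k M []       []       _            e+k≡0 = ℕP.m+n≡0⇒m≡0 e e+k≡0
  addAt-carry e k M (a ∷ xs) (b ∷ ys) (b≤M ∷ ys≤M) (d , eq , carry) with a ℕP.≤? M
  ... | yes _   = d , ≡-trans (≡-sym (ℕ+.xy∙z≈x∙zy e k a)) eq , carry
  ... | no  a≰M with surplus-split {e} {k} (ℕP.<⇒≤ (ℕP.≤-<-trans b≤M (ℕP.≰⇒> a≰M))) eq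
  ...   | d′ , e+a≡b+d′ , d≡d′+k =
    d′ , e+a≡b+d′ , addAt-carry d′ k M xs ys ys≤M (subst (λ s → Carry s xs ys) d≡d′+k carry)

  prefix-dominance⇒carry : ∀ e xs ys → length xs ≡ length ys → e + sumL xs ≡ sumL ys →
    (∀ j → sumL (take j ys) ≤ e + sumL (take j xs)) → Carry e xs ys
  prefix-dominance⇒carry e []       []       _  e+0≡0 _ = ≡-trans (≡-sym (ℕP.+-identityʳ e)) e+0≡0
  prefix-dominance⇒carry e []       (_ ∷ _)  () _     _
  prefix-dominance⇒carry e (_ ∷ _)  []       () _     _
  prefix-dominance⇒carry e (a ∷ xs) (b ∷ ys) len total prefix =
    d , e+a≡b+d , prefix-dominance⇒carry d xs ys (ℕP.suc-injective len) total′ prefix′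
    where
    b≤e+a : b ≤ e + a
    b≤e+a = subst₂ _≤_ (ℕP.+-identityʳ b) (cong (e +_) (ℕP.+-identityʳ a)) (prefix 1)
    d : ℕ
    d = e + a ∸ b
    e+a≡b+d : e + a ≡ b + d
    e+a≡b+d = ≡-sym (ℕP.m+[n∸m]≡n b≤e+a)
    shift : ∀ t → e + (a + t) ≡ b + (d + t)
    shift t = begin
      e + (a + t)  ≡⟨ ≡-sym (ℕP.+-assoc e a t) ⟩
      e + a + t    ≡⟨ cong (_+ t) e+a≡b+d ⟩
      b + d + t    ≡⟨ ℕP.+-assoc b d t ⟩
      b + (d + t)  ∎
      where open ≡-Reasoning
    total′ : d + sumL xs ≡ sumL ys
    total′ = ℕP.+-cancelˡ-≡ b _ _ (≡-trans (≡-sym (shift (sumL xs))) total)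
    prefix′ : ∀ j → sumL (take j ys) ≤ d + sumL (take j xs)
    prefix′ j = ℕP.+-cancelˡ-≤ b _ _ (subst (b + sumL (take j ys) ≤_) (shift (sumL (take j xs))) (prefix (suc j)))

  module DescendingSort = SortProperties (Flip.decTotalOrder ℕP.≤-decTotalOrder)

  Descending : List ℕ → Set
  Descending = AllPairs (λ x y → y ≤ x)

  decreasing-↭ : ∀ {m} (v : Vec ℕ m) → decreasing v ↭ toList v
  decreasing-↭ v = DescendingSort.sort-↭ (toList v)

  decreasing-descending : ∀ {m} (v : Vec ℕ m) → Descending (decreasing v)
  decreasing-descending v =
    Linked⇒AllPairs (λ y≤x z≤y → ℕP.≤-trans z≤y y≤x) (DescendingSort.sort-↗ (toList v))

  decreasing-length : ∀ {m} (v : Vec ℕ m) → length (decreasing v) ≡ m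
  decreasing-length v = ≡-trans (Perm.↭-length (decreasing-↭ v)) (VP.length-toList v)

  decreasing-sum : ∀ {m} (v : Vec ℕ m) → sumL (decreasing v) ≡ sumV v
  decreasing-sum v = ≡-trans (SumL.sum-↭ (decreasing-↭ v)) (sumL-toList v)
    where
    sumL-toList : ∀ {m} (v : Vec ℕ m) → sumL (toList v) ≡ sumV v
    sumL-toList []      = refl
    sumL-toList (k ∷ v) = cong (k +_) (sumL-toList v)

  dominance⇒carry : ∀ {m} (l u : Vec ℕ m) → l ⊵ u → Carry 0 (decreasing l) (decreasing u)
  dominance⇒carry {m} l u (Σl≡Σu , dominates) =
    prefix-dominance⇒carry 0 xs ys (≡-trans (decreasing-length l) (≡-sym (decreasing-length u))) total prefix
    where
    xs ys : List ℕ
    xs = decreasing l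
    ys = decreasing u
    total : sumL xs ≡ sumL ys
    total = ≡-trans (decreasing-sum l) (≡-trans Σl≡Σu (≡-sym (decreasing-sum u)))
    whole : ∀ j (zs : List ℕ) → length zs ≡ m → m ≤ j → take j zs ≡ zs
    whole j zs len m≤j = LP.take-all j zs (subst (_≤ j) (≡-sym len) m≤j)
    prefix : ∀ j → sumL (take j ys) ≤ sumL (take j xs)
    prefix zero = z≤n
    prefix (suc j) with suc j ℕP.≤? m
    ... | yes 1+j≤m = dominates (suc j) (s≤s z≤n) 1+j≤m
    ... | no  1+j≰m = subst₂ _≤_ (cong sumL (≡-sym (whole (suc j) ys (decreasing-length u) m≤j)))
                                 (cong sumL (≡-sym (whole (suc j) xs (decreasing-length l) m≤j)))
                                 (ℕP.≤-reflexive (≡-sym total))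
      where
      m≤j : m ≤ suc j
      m≤j = ℕP.<⇒≤ (ℕP.≰⇒> 1+j≰m)

module Toeplitz {c ℓ₁ ℓ₂} (R : CompleteOrderedField c ℓ₁ ℓ₂) where
  open CompleteOrderedField R
    renaming (refl to ≈-refl; sym to ≈-sym; trans to ≈-trans; reflexive to ≈-reflexive)
  open OrderedField R

  Exchange : (ℕ → Carrier) → Set ℓ₂
  Exchange p = ∀ a M k → a ≤ℕ M → (p (M +ℕ k) * p a) ≤ (p M * p (a +ℕ k))

  module _ (p : ℕ → Carrier) where

    𝒯-upper : ∀ i j → i ≤ℕ j → 𝒯 R p i j ≡ p (j ∸ i)
    𝒯-upper i j i≤j with j ℕP.<? i
    ... | yes j<i = ⊥-elim (ℕP.<⇒≱ j<i i≤j)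
    ... | no  _   = refl

    𝒯-shift : ∀ k n → 𝒯 R p k (n +ℕ k) ≡ p n
    𝒯-shift k n = ≡-trans (𝒯-upper k (n +ℕ k) (ℕP.m≤n+m k n)) (cong p (ℕP.m+n∸n≡m n k))

    -- row 0 of 𝒯_p is p itself
    TN₂⇒nonneg : TN₂ R (𝒯 R p) → ∀ n → 0# ≤ p n
    TN₂⇒nonneg (entries , _) n = subst (0# ≤_) (𝒯-upper 0 n z≤n) (entries 0 n)

    -- the minor on rows 0 < k and columns a + k < M + k
    TN₂⇒exchange : TN₂ R (𝒯 R p) → Exchange p
    TN₂⇒exchange _ a M zero _ =
      ≤-reflexive (*-cong (≈-reflexive (cong p (ℕP.+-identityʳ M))) (≈-reflexive (cong p (≡-sym (ℕP.+-identityʳ a)))))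
    TN₂⇒exchange (_ , minors) a M (suc k) a≤M with ℕP.m≤n⇒m<n∨m≡n a≤M
    ... | inj₂ refl = ≤-reflexive (*-comm _ _)
    ... | inj₁ a<M  = ≤-respʳ (*-comm _ _) (0≤y-x⇒x≤y (subst (0# ≤_) minor≡ minor))
      where
      K : ℕ
      K = suc k
      minor : 0# ≤ ((𝒯 R p 0 (a +ℕ K) * 𝒯 R p K (M +ℕ K)) - (𝒯 R p 0 (M +ℕ K) * 𝒯 R p K (a +ℕ K)))
      minor = minors 0 K (a +ℕ K) (M +ℕ K) (s≤s z≤n) (ℕP.+-monoˡ-< K a<M)
      minor≡ : ((𝒯 R p 0 (a +ℕ K) * 𝒯 R p K (M +ℕ K)) - (𝒯 R p 0 (M +ℕ K) * 𝒯 R p K (a +ℕ K)))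
             ≡ ((p (a +ℕ K) * p M) - (p (M +ℕ K) * p a))
      minor≡ = cong₂ _-_ (cong₂ _*_ (𝒯-upper 0 (a +ℕ K) z≤n) (𝒯-shift K M))
                         (cong₂ _*_ (𝒯-upper 0 (M +ℕ K) z≤n) (𝒯-shift K a))

module Weights {c ℓ₁ ℓ₂} (R : CompleteOrderedField c ℓ₁ ℓ₂) (p : ℕ → CompleteOrderedField.Carrier R) where
  open CompleteOrderedField R hiding (zero)
    renaming (refl to ≈-refl; sym to ≈-sym; trans to ≈-trans; reflexive to ≈-reflexive)
  open OrderedField R
  open Toeplitz R using (Exchange)
  open Compositions
  open Carrying
  import Algebra.Properties.CommutativeSemigroup *-commutativeSemigroup as *-CS

  weight : List ℕ → Carrier
  weight xs = foldr _*_ 1# (map p xs)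

  weight-↭ : ∀ {xs ys} → xs ↭ ys → weight xs ≈ weight ys
  weight-↭ xs↭ys = SetoidPerm.foldr-commMonoid setoid *-isCommutativeMonoid
                     (↭⇒↭ₛ′ isEquivalence (Perm.map⁺ p xs↭ys))

  weight-++ : ∀ xs ys → weight (xs ++ ys) ≈ (weight xs * weight ys)
  weight-++ []       ys = ≈-sym (*-identityˡ _)
  weight-++ (k ∷ xs) ys = ≈-trans (*-cong ≈-refl (weight-++ xs ys)) (≈-sym (*-assoc _ _ _))

  compWeight : ∀ {m n} → Comp m n → Carrier
  compWeight λ′ = weight (toList (proj₁ λ′))

  pairWeight : ∀ {A a B b} → Comp A a × Comp B b → Carrier
  pairWeight (λ′ , μ) = compWeight λ′ * compWeight μ

  pairWeight≈weight-concat : ∀ {A a B b} (x : Comp A a × Comp B b) → pairWeight x ≈ weight (toList (concat x))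
  pairWeight≈weight-concat ((l , _) , (u , _)) =
    ≈-trans (≈-sym (weight-++ (toList l) (toList u))) (≈-reflexive (cong weight (≡-sym (VP.toList-++ l u))))

  compositionSum : ℕ → ℕ → Carrier
  compositionSum m n = ∑ compWeight (compositions m n)

  firstWeighted : ∀ {m n} → (ℕ → Carrier) → Comp (suc m) n → Carrier
  firstWeighted f (k ∷ v , _) = f k * weight (toList v)

  ∑-prepend0 : ∀ f m n → ∑ (firstWeighted f) (map prepend0 (compositions m n)) ≈ (f 0 * compositionSum m n)
  ∑-prepend0 f m n = ≈-trans (≈-reflexive (∑-map (firstWeighted f) prepend0 (compositions m n)))
                             (∑-scale (f 0) compWeight (compositions m n))

  ∑-bumpHead : ∀ f m n → ∑ (firstWeighted f) (map bumpHead (compositionsSuc m n))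
                       ≈ ∑ (firstWeighted (λ k → f (suc k))) (compositionsSuc m n)
  ∑-bumpHead f m n = ≈-trans (≈-reflexive (∑-map (firstWeighted f) bumpHead (compositionsSuc m n)))
                             (∑-cong shifted (compositionsSuc m n))
    where
    shifted : ∀ (λ′ : Comp (suc m) n) → firstWeighted f (bumpHead λ′) ≈ firstWeighted (λ k → f (suc k)) λ′
    shifted (k ∷ v , _) = ≈-refl

  ∑-firstWeighted : ∀ f m n →
    ∑ (firstWeighted f) (compositionsSuc m n) ≈ sumRange R (suc n) (λ k → f k * compositionSum m (n ∸ k))
  ∑-firstWeighted f m zero = ≈-trans (∑-prepend0 f m zero) (≈-sym (+-identityˡ _))
  ∑-firstWeighted f m (suc n) = begin
    ∑ (firstWeighted f) (map prepend0 (compositions m (suc n)) ++ map bumpHead (compositionsSuc m n))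
      ≈⟨ ∑-++ (firstWeighted f) (map prepend0 (compositions m (suc n))) (map bumpHead (compositionsSuc m n)) ⟩
    ∑ (firstWeighted f) (map prepend0 (compositions m (suc n))) + ∑ (firstWeighted f) (map bumpHead (compositionsSuc m n))
      ≈⟨ +-cong (∑-prepend0 f m (suc n)) (∑-bumpHead f m n) ⟩
    f 0 * compositionSum m (suc n) + ∑ (firstWeighted (λ k → f (suc k))) (compositionsSuc m n)
      ≈⟨ +-cong ≈-refl (∑-firstWeighted (λ k → f (suc k)) m n) ⟩
    f 0 * compositionSum m (suc n) + sumRange R (suc n) (λ k → f (suc k) * compositionSum m (n ∸ k))
      ≈⟨ ≈-sym (sumRange-head (suc n) (λ k → f k * compositionSum m (suc n ∸ k))) ⟩
    sumRange R (suc (suc n)) (λ k → f k * compositionSum m (suc n ∸ k)) ∎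
    where open ≈-Reasoning

  powCoeff≈compositionSum : ∀ m n → powCoeff R p m n ≈ compositionSum m n
  powCoeff≈compositionSum zero    zero    = ≈-sym (+-identityʳ _)
  powCoeff≈compositionSum zero    (suc n) = ≈-refl
  powCoeff≈compositionSum (suc m) n = begin
    sumRange R (suc n) (λ k → p k * powCoeff R p m (n ∸ k))
      ≈⟨ sumRange-cong (suc n) (λ k → *-cong ≈-refl (powCoeff≈compositionSum m (n ∸ k))) ⟩
    sumRange R (suc n) (λ k → p k * compositionSum m (n ∸ k))
      ≈⟨ ≈-sym (∑-firstWeighted p m n) ⟩
    ∑ (firstWeighted p) (compositionsSuc m n)
      ≈⟨ ∑-cong firstWeighted≈compWeight (compositionsSuc m n) ⟩
    compositionSum (suc m) n ∎
    where
    open ≈-Reasoning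
    firstWeighted≈compWeight : ∀ (λ′ : Comp (suc m) n) → firstWeighted p λ′ ≈ compWeight λ′
    firstWeighted≈compWeight (k ∷ v , _) = ≈-refl

  module _ (p≥0 : ∀ n → 0# ≤ p n) where

    weight-nonneg : ∀ xs → 0# ≤ weight xs
    weight-nonneg []       = 0≤1
    weight-nonneg (k ∷ ks) = *-nonneg (p≥0 k) (weight-nonneg ks)

    compWeight-nonneg : ∀ {m n} (λ′ : Comp m n) → 0# ≤ compWeight λ′
    compWeight-nonneg λ′ = weight-nonneg (toList (proj₁ λ′))

    module _ (exchange : Exchange p) where

      addAt-weight : ∀ e k M xs ys → All (_≤ℕ M) ys → Carry (e +ℕ k) xs ys →
        (p (M +ℕ k) * weight xs) ≤ (p M * weight (addAt k M xs))
      addAt-weight e k M [] [] _ e+k≡0 with ℕP.m+n≡0⇒n≡0 e e+k≡0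
      ... | refl = ≤-reflexive (*-cong (≈-reflexive (cong p (ℕP.+-identityʳ M))) ≈-refl)
      addAt-weight e k M (a ∷ xs) (b ∷ ys) (b≤M ∷ ys≤M) (d , eq , carry) with a ℕP.≤? M
      ... | yes a≤M = begin
        p (M +ℕ k) * (p a * weight xs)   ≈⟨ ≈-sym (*-assoc _ _ _) ⟩
        p (M +ℕ k) * p a * weight xs     ≤⟨ *-monoʳ-≤ (weight xs) (weight-nonneg xs) (exchange a M k a≤M) ⟩
        p M * p (a +ℕ k) * weight xs     ≈⟨ *-assoc _ _ _ ⟩
        p M * (p (a +ℕ k) * weight xs)   ∎
        where open ≤-Reasoning
      ... | no  a≰M with surplus-split {e} {k} (ℕP.<⇒≤ (ℕP.≤-<-trans b≤M (ℕP.≰⇒> a≰M))) eq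
      ...   | d′ , _ , d≡d′+k = begin
        p (M +ℕ k) * (p a * weight xs)            ≈⟨ *-CS.x∙yz≈y∙xz _ _ _ ⟩
        p a * (p (M +ℕ k) * weight xs)            ≤⟨ *-monoˡ-≤ (p a) (p≥0 a) moved ⟩
        p a * (p M * weight (addAt k M xs))       ≈⟨ *-CS.x∙yz≈y∙xz _ _ _ ⟩
        p M * (p a * weight (addAt k M xs))       ∎
        where
        open ≤-Reasoning
        moved : (p (M +ℕ k) * weight xs) ≤ (p M * weight (addAt k M xs))
        moved = addAt-weight d′ k M xs ys ys≤M (subst (λ s → Carry s xs ys) d≡d′+k carry)

      carry⇒weight-≤ : ∀ xs ys → Descending ys → Carry 0 xs ys → weight xs ≤ weight ys
      carry⇒weight-≤ []       []       _               _                 = ≤-refl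
      carry⇒weight-≤ (a ∷ xs) (b ∷ ys) (ys≤b ∷ ys-desc) (d , a≡b+d , carry) = begin
        p a * weight xs               ≡⟨ cong (λ t → p t * weight xs) a≡b+d ⟩
        p (b +ℕ d) * weight xs        ≤⟨ addAt-weight 0 d b xs ys ys≤b carry ⟩
        p b * weight (addAt d b xs)   ≤⟨ *-monoˡ-≤ (p b) (p≥0 b) (carry⇒weight-≤ (addAt d b xs) ys ys-desc
                                                                  (addAt-carry 0 d b xs ys ys≤b carry)) ⟩
        p b * weight ys               ∎
        where open ≤-Reasoning

      dominance⇒weight-≤ : ∀ {m} (l u : Vec ℕ m) → l ⊵ u → weight (toList l) ≤ weight (toList u)
      dominance⇒weight-≤ l u l⊵u =
        ≤-respˡ (weight-↭ (decreasing-↭ l)) (≤-respʳ (weight-↭ (decreasing-↭ u))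
          (carry⇒weight-≤ (decreasing l) (decreasing u) (decreasing-descending u) (dominance⇒carry l u l⊵u)))

module Powers {c ℓ₁ ℓ₂} (R : CompleteOrderedField c ℓ₁ ℓ₂) (p : ℕ → CompleteOrderedField.Carrier R)
              (p≥0 : ∀ n → CompleteOrderedField._≤_ R (CompleteOrderedField.0# R) (p n))
              (exchange : Toeplitz.Exchange R p) where
  open CompleteOrderedField R hiding (zero)
    renaming (refl to ≈-refl; sym to ≈-sym; trans to ≈-trans; reflexive to ≈-reflexive)
  open OrderedField R
  open Compositions
  open Weights R p

  -- entries of 𝒮_p are sums of non-negative weights
  𝒮-nonneg : ∀ i j → 0# ≤ 𝒮 R p i j
  𝒮-nonneg i j = ≤-respʳ (≈-sym (powCoeff≈compositionSum i j))
                   (∑-nonneg compWeight (compWeight-nonneg p≥0) (compositions i j))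

  𝒮-product : ∀ i j i′ j′ →
    (𝒮 R p i j * 𝒮 R p i′ j′) ≈ ∑ pairWeight (cartesianProduct (compositions i′ j′) (compositions i j))
  𝒮-product i j i′ j′ = begin
    𝒮 R p i j * 𝒮 R p i′ j′
      ≈⟨ *-cong (powCoeff≈compositionSum i j) (powCoeff≈compositionSum i′ j′) ⟩
    compositionSum i j * compositionSum i′ j′
      ≈⟨ *-comm _ _ ⟩
    compositionSum i′ j′ * compositionSum i j
      ≈⟨ ≈-sym (∑-cartesian compWeight compWeight (compositions i′ j′) (compositions i j)) ⟩
    ∑ pairWeight (cartesianProduct (compositions i′ j′) (compositions i j)) ∎
    where open ≈-Reasoning

  -- the injection γ of (*) compares the two products of the minor termwise
  𝒮-minor : Star → ∀ i i′ j j′ → i <ℕ i′ → j <ℕ j′ →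
    0# ≤ ((𝒮 R p i j * 𝒮 R p i′ j′) - (𝒮 R p i j′ * 𝒮 R p i′ j))
  𝒮-minor star i i′ j j′ i<i′ j<j′ with star i′ j′ i j (ℕP.<⇒≤ i<i′) (ℕP.<⇒≤ j<j′)
  ... | γ , γ-injective , γ-dominance = x≤y⇒0≤y-x (begin
    𝒮 R p i j′ * 𝒮 R p i′ j
      ≈⟨ 𝒮-product i j′ i′ j ⟩
    ∑ pairWeight (cartesianProduct (compositions i′ j) (compositions i j′))
      ≤⟨ ∑-injection pairWeight pairWeight γ pairWeight-nonneg γ-injective γ-increases _ _
           (Unique.cartesianProduct⁺ (compositions-unique i′ j) (compositions-unique i j′))
           (λ y → ∈-cartesianProduct⁺ (compositions-complete i′ j′ (proj₁ y)) (compositions-complete i j (proj₂ y))) ⟩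
    ∑ pairWeight (cartesianProduct (compositions i′ j′) (compositions i j))
      ≈⟨ ≈-sym (𝒮-product i j i′ j′) ⟩
    𝒮 R p i j * 𝒮 R p i′ j′ ∎)
    where
    open ≤-Reasoning
    pairWeight-nonneg : ∀ (y : Comp i′ j′ × Comp i j) → 0# ≤ pairWeight y
    pairWeight-nonneg (λ′ , μ) = *-nonneg (compWeight-nonneg p≥0 λ′) (compWeight-nonneg p≥0 μ)
    γ-increases : ∀ x → pairWeight x ≤ pairWeight (γ x)
    γ-increases x = ≤-respˡ (≈-sym (pairWeight≈weight-concat x)) (≤-respʳ (≈-sym (pairWeight≈weight-concat (γ x)))
                      (dominance⇒weight-≤ p≥0 exchange (concat x) (concat (γ x)) (γ-dominance x)))

theorem4 : Star → ∀ {c ℓ₁ ℓ₂} (R : CompleteOrderedField c ℓ₁ ℓ₂) →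
    (p : ℕ → CompleteOrderedField.Carrier R) →
    TN₂ R (𝒯 R p) → TN₂ R (𝒮 R p)
theorem4 star R p 𝒯-TN₂ = 𝒮-nonneg , 𝒮-minor star
  where
  open Toeplitz R using (TN₂⇒nonneg; TN₂⇒exchange)
  open Powers R p (TN₂⇒nonneg p 𝒯-TN₂) (TN₂⇒exchange p 𝒯-TN₂)
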